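{- If $\models_{\mathbf{A}} G$ for a hypersequent $G$, then for every propositional variable $p$ the focused hypersequent $[p]G$ is derivable in $\mathbf{GA_t}$.
   Context: Formulas are built from propositional variables and $t$ using $+,\to,\land,\lor,\lnot$. A sequent (component) is a pair of finite multisets $\Gamma\vdash\Delta$; a hypersequent a finite multiset of components. $\models_{\mathbf{A}}G$ means: for every valuation into $\mathbb{Q}$ ($t=0$, $+$ addition, $\lnot$ negation, $A\to B$ valued $v(B)-v(A)$, $\land=\min$, $\lor=\max$) some component $\Gamma_i\vdash\Delta_i$ of $G$ has $\sum v(\Gamma_i)\le\sum v(\Delta_i)$ (empty sum $0$). A focused hypersequent $[q]G$ is a hypersequent $G$ together with a propositional variable $q$. $m\Gamma$ is $m$ copies of $\Gamma$, $np$ is $n$ copies of $p$; "atomic" means consisting of propositional variables. Calculus $\mathbf{GA_t}$ (same focus $[q]$ in premises and conclusion unless stated; each logical rule carries a side hypersequent $[q]G\mid$): axioms $[q]A\vdash A$ and $[q]\vdash$; (EW) from $[q]G\mid\Gamma\vdash\Delta$ infer $[q]G\mid\Gamma\vdash\Delta\mid\Gamma'\vdash\Delta'$; (M) from $[q]G\mid\Gamma_1\vdash\Delta_1$ and $[q]G\mid\Gamma_2\vdash\Delta_2$ infer $[q]G\mid\Gamma_1,\Gamma_2\vdash\Delta_1,\Delta_2$; logical rules $(t,l)$ $\Gamma\vdash\Delta/\Gamma,t\vdash\Delta$; $(t,r)$ $\Gamma\vdash\Delta/\Gamma\vdash t,\Delta$; $(\lnot,l)$ $\Gamma\vdash A,\Delta/\Gamma,\lnot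 A\vdash\Delta$; $(\lnot,r)$ $\Gamma,A\vdash\Delta/\Gamma\vdash\lnot A,\Delta$; $(\to,l)$ $\Gamma,B\vdash A,\Delta/\Gamma,A\to B\vdash\Delta$; $(\to,r)$ $\Gamma,A\vdash B,\Delta/\Gamma\vdash A\to B,\Delta$; $(+,l)$ $\Gamma,A,B\vdash\Delta/\Gamma,A+B\vdash\Delta$; $(+,r)$ $\Gamma\vdash A,B,\Delta/\Gamma\vdash A+B,\Delta$; $(\land,l)$ $\Gamma,A\vdash\Delta\mid\Gamma,B\vdash\Delta/\Gamma,A\land B\vdash\Delta$; $(\land,r)$ premises $\Gamma\vdash A,\Delta$ and $\Gamma\vdash B,\Delta$, conclusion $\Gamma\vdash A\land B,\Delta$; $(\lor,l)$ premises $\Gamma,A\vdash\Delta$ and $\Gamma,B\vdash\Delta$, conclusion $\Gamma,A\lor B\vdash\Delta$; $(\lor,r)$ $\Gamma\vdash A,\Delta\mid\Gamma\vdash B,\Delta/\Gamma\vdash A\lor B,\Delta$; (shift) from $[q]G$ infer $[p]G$ provided $q$ occurs in $G$ and $p$ does not; (S') from $[p]G\mid m\Gamma_1,n\Gamma_2\vdash m\Delta_1,n\Delta_2\mid S$ infer $[p]G\mid\Gamma_1,np\vdash\Delta_1\mid\Gamma_2\vdash\Delta_2,mp$, provided $\Gamma_1,\Gamma_2,\Delta_1,\Delta_2$ atomic, $n,m>0$, $p$ not in $\Gamma_1,\Delta_1,\Gamma_2,\Delta_2$, and $S$ is $\Gamma_1,np\vdash\Delta_1$ or $\Gamma_2\vdash\Delta_2,mp$.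 -}

module Defs where

open import Data.Nat using (ℕ; zero; suc) renaming (_≤_ to _≤ℕ_)
open import Data.Rational using (ℚ; 0ℚ; _≤_; _⊔_; _⊓_) renaming (_+_ to _+ℚ_; _-_ to _-ℚ_; -_ to -ℚ_)
open import Data.List using (List; []; _∷_; _++_; replicate; concat; foldr; [_])
open import Data.List.Relation.Unary.All using (All)
open import Data.List.Relation.Unary.Any using (Any)
open import Data.List.Relation.Binary.Permutation.Propositional using (_↭_)
open import Data.List.Relation.Binary.Pointwise using (Pointwise)
open import Data.Product using (_×_; _,_; proj₁; proj₂; Σ)
open import Data.Sum using (_⊎_)
open import Data.Empty using (⊥)
open import Relation.Binary.PropositionalEquality using (_≡_)
open import Relation.Nullary using (¬_)

Var : Set
Var = ℕ

infixr 6 _⊕_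
infixr 5 _⇒_
infixr 7 _∧_
infixr 6 _∨_

data Formula : Set where
  var  : Var → Formula
  t    : Formula
  _⊕_  : Formula → Formula → Formula
  _⇒_  : Formula → Formula → Formula
  _∧_  : Formula → Formula → Formula
  _∨_  : Formula → Formula → Formula
  ¬ᶠ_  : Formula → Formula

-- Sequents: pairs of finite multisets, represented as lists (order is
-- quotiented out by the (perm) rule below).
Sequent : Set
Sequent = List Formula × List Formula

-- Hypersequents: finite multisets of sequents, represented as lists.
Hypersequent : Set
Hypersequent = List Sequent

Valuation : Set
Valuation = Var → ℚ

⟦_⟧ : Formula → Valuation → ℚ
⟦ var p ⟧ v = v p
⟦ t ⟧ v = 0ℚ
⟦ A ⊕ B ⟧ v = ⟦ A ⟧ v +ℚ ⟦ B ⟧ v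
⟦ A ⇒ B ⟧ v = ⟦ B ⟧ v -ℚ ⟦ A ⟧ v
⟦ A ∧ B ⟧ v = ⟦ A ⟧ v ⊓ ⟦ B ⟧ v
⟦ A ∨ B ⟧ v = ⟦ A ⟧ v ⊔ ⟦ B ⟧ v
⟦ ¬ᶠ A ⟧ v = -ℚ (⟦ A ⟧ v)

sumV : Valuation → List Formula → ℚ
sumV v = foldr (λ A r → ⟦ A ⟧ v +ℚ r) 0ℚ

HoldsSeq : Valuation → Sequent → Set
HoldsSeq v (Γ , Δ) = sumV v Γ ≤ sumV v Δ

Valid : Hypersequent → Set
Valid G = (v : Valuation) → Any (HoldsSeq v) G

OccursF : Var → Formula → Set
OccursF q (var p) = q ≡ p
OccursF q t = ⊥
OccursF q (A ⊕ B) = OccursF q A ⊎ OccursF q B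
OccursF q (A ⇒ B) = OccursF q A ⊎ OccursF q B
OccursF q (A ∧ B) = OccursF q A ⊎ OccursF q B
OccursF q (A ∨ B) = OccursF q A ⊎ OccursF q B
OccursF q (¬ᶠ A) = OccursF q A

OccursL : Var → List Formula → Set
OccursL q Γ = Any (OccursF q) Γ

OccursH : Var → Hypersequent → Set
OccursH q G = Any (λ s → OccursL q (proj₁ s) ⊎ OccursL q (proj₂ s)) G

IsAtom : Formula → Set
IsAtom A = Σ Var (λ p → A ≡ var p)

Atomic : List Formula → Set
Atomic Γ = All IsAtom Γ

_·_ : ℕ → List Formula → List Formula
m · Γ = concat (replicate m Γ)

_≈S_ : Sequent → Sequent → Set
(Γ , Δ) ≈S (Γ′ , Δ′) = (Γ ↭ Γ′) × (Δ ↭ Δ′)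

_≈H_ : Hypersequent → Hypersequent → Set
G ≈H G′ = Σ Hypersequent (λ G″ → (G ↭ G″) × Pointwise _≈S_ G″ G′)

-- The calculus GA_t.  ⊢[ q ] G  means the focused hypersequent [q]G is
-- derivable.  A hypersequent  G | S  is written  S ∷ G.

infix 4 ⊢[_]_

data ⊢[_]_ : Var → Hypersequent → Set where
  perm  : ∀ {q G G′} → G ≈H G′ → ⊢[ q ] G → ⊢[ q ] G′
  ax    : ∀ {q} A → ⊢[ q ] ([ A ] , [ A ]) ∷ []
  ax∅   : ∀ {q} → ⊢[ q ] ([] , []) ∷ []
  ew    : ∀ {q G S} S′ → ⊢[ q ] S ∷ G → ⊢[ q ] S′ ∷ S ∷ G
  mix   : ∀ {q G Γ₁ Δ₁ Γ₂ Δ₂} → ⊢[ q ] (Γ₁ , Δ₁) ∷ G → ⊢[ q ] (Γ₂ , Δ₂) ∷ G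
        → ⊢[ q ] (Γ₁ ++ Γ₂ , Δ₁ ++ Δ₂) ∷ G
  tl    : ∀ {q G Γ Δ} → ⊢[ q ] (Γ , Δ) ∷ G → ⊢[ q ] (t ∷ Γ , Δ) ∷ G
  tr    : ∀ {q G Γ Δ} → ⊢[ q ] (Γ , Δ) ∷ G → ⊢[ q ] (Γ , t ∷ Δ) ∷ G
  ¬l    : ∀ {q G Γ Δ A} → ⊢[ q ] (Γ , A ∷ Δ) ∷ G → ⊢[ q ] ((¬ᶠ A) ∷ Γ , Δ) ∷ G
  ¬r    : ∀ {q G Γ Δ A} → ⊢[ q ] (A ∷ Γ , Δ) ∷ G → ⊢[ q ] (Γ , (¬ᶠ A) ∷ Δ) ∷ G
  ⇒l    : ∀ {q G Γ Δ A B} → ⊢[ q ] (B ∷ Γ , A ∷ Δ) ∷ G → ⊢[ q ] ((A ⇒ B) ∷ Γ , Δ) ∷ G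
  ⇒r    : ∀ {q G Γ Δ A B} → ⊢[ q ] (A ∷ Γ , B ∷ Δ) ∷ G → ⊢[ q ] (Γ , (A ⇒ B) ∷ Δ) ∷ G
  ⊕l    : ∀ {q G Γ Δ A B} → ⊢[ q ] (A ∷ B ∷ Γ , Δ) ∷ G → ⊢[ q ] ((A ⊕ B) ∷ Γ , Δ) ∷ G
  ⊕r    : ∀ {q G Γ Δ A B} → ⊢[ q ] (Γ , A ∷ B ∷ Δ) ∷ G → ⊢[ q ] (Γ , (A ⊕ B) ∷ Δ) ∷ G
  ∧l    : ∀ {q G Γ Δ A B} → ⊢[ q ] (A ∷ Γ , Δ) ∷ (B ∷ Γ , Δ) ∷ G
        → ⊢[ q ] ((A ∧ B) ∷ Γ , Δ) ∷ G
  ∧r    : ∀ {q G Γ Δ A B} → ⊢[ q ] (Γ , A ∷ Δ) ∷ G → ⊢[ q ] (Γ , B ∷ Δ) ∷ G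
        → ⊢[ q ] (Γ , (A ∧ B) ∷ Δ) ∷ G
  ∨l    : ∀ {q G Γ Δ A B} → ⊢[ q ] (A ∷ Γ , Δ) ∷ G → ⊢[ q ] (B ∷ Γ , Δ) ∷ G
        → ⊢[ q ] ((A ∨ B) ∷ Γ , Δ) ∷ G
  ∨r    : ∀ {q G Γ Δ A B} → ⊢[ q ] (Γ , A ∷ Δ) ∷ (Γ , B ∷ Δ) ∷ G
        → ⊢[ q ] (Γ , (A ∨ B) ∷ Δ) ∷ G
  shift : ∀ {q p G} → OccursH q G → ¬ OccursH p G → ⊢[ q ] G → ⊢[ p ] G
  S′    : ∀ {p G Γ₁ Δ₁ Γ₂ Δ₂ m n} → Atomic Γ₁ → Atomic Δ₁ → Atomic Γ₂ → Atomic Δ₂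
        → 1 ≤ℕ n → 1 ≤ℕ m
        → ¬ OccursL p Γ₁ → ¬ OccursL p Δ₁ → ¬ OccursL p Γ₂ → ¬ OccursL p Δ₂
        → (S : Sequent)
        → (S ≡ (Γ₁ ++ replicate n (var p) , Δ₁)) ⊎ (S ≡ (Γ₂ , Δ₂ ++ replicate m (var p)))
        → ⊢[ p ] (m · Γ₁ ++ n · Γ₂ , m · Δ₁ ++ n · Δ₂) ∷ S ∷ G
        → ⊢[ p ] (Γ₁ ++ replicate n (var p) , Δ₁) ∷ (Γ₂ , Δ₂ ++ replicate m (var p)) ∷ G

module Submission where

-- Completeness is proved through a decision procedure: every hypersequent
-- is derivable (with any focus) or has a rational countermodel.  The logical
-- rules are invertible, syntactically and semantically, and lower a
-- multiplicative weight, so only atomic hypersequents remain.  There one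
-- variable p is eliminated at a time.  After cancelling the copies of p common
-- to both sides of a component, p occurs on one side only.  A component with
-- surplus p on the left and one with surplus p on the right are resolved by
-- (S′), whose premise keeps one of the two next to a p-free combination of
-- both; if neither choice is derivable, the two countermodels found
-- recursively mix with positive weights into a countermodel of the
-- conclusion, since the semantics is linear.  Once surpluses remain on one
-- side only, a countermodel of the p-free part extends to them by giving p a
-- large enough value.  Variables are eliminated from a shrinking finite set,
-- and (shift) moves the focus onto a variable that occurs.

open import Defs

open import Data.Empty using (⊥-elim)
open import Data.Nat as ℕ using (ℕ; zero; suc; NonZero; compare; less; equal; greater)
open import Data.List using (List; []; _∷_; _++_; map; replicate; concat; length; filter)
open import Data.List.Properties
  using (++-assoc; ++-identityʳ; ++-conicalˡ; ++-conicalʳ; map-++; map-replicate; concat-map; filter-notAll)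
open import Data.List.Membership.Propositional using (_∈_; _∉_)
open import Data.List.Membership.Propositional.Properties using (∈-filter⁺; ∈-filter⁻; ∈-++⁺ˡ; ∈-++⁺ʳ; ∈-++⁻)
open import Data.List.Membership.DecPropositional ℕ._≟_ using (_∈?_)
open import Data.List.Relation.Unary.All as All using (All; []; _∷_)
open import Data.List.Relation.Unary.All.Properties using (All¬⇒¬Any; ++⁺; concat⁺; replicate⁺)
  renaming (map⁺ to All-map⁺; map⁻ to All-map⁻)
open import Data.List.Relation.Unary.Any as Any using (Any; here; there)
open import Data.List.Relation.Unary.Any.Properties using () renaming (map⁺ to Any-map⁺; map⁻ to Any-map⁻)
open import Data.List.Relation.Binary.Pointwise as Pointwise using (Pointwise; []; _∷_)
import Data.List.Relation.Binary.Permutation.Propositional as ↭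
open ↭ using (_↭_; ↭-refl; ↭-sym; ↭-trans; ↭-reflexive; prep; swap)
open import Data.List.Relation.Binary.Permutation.Propositional.Properties
  using (All-resp-↭; ↭-empty-inv; ++-comm; ++⁺ˡ; ++⁺ʳ)
  renaming (shift to ↭-shift; ++⁺ to ++-↭⁺; map⁺ to map-↭⁺)
import Data.Nat.Properties as ℕₚ
open import Data.Nat.Induction using (<-wellFounded)
open import Data.Nat.ListAction using (sum; product)
open import Data.Nat.ListAction.Properties using (sum-↭; product-↭; product≢0)
open import Data.Product using (Σ; _×_; _,_; proj₁; proj₂)
open import Data.Rational using (ℚ; 0ℚ; 1ℚ; _+_; _*_; _-_; -_; _≤_; _<_; _⊔_; positive; nonNegative)
open import Data.Rational.Properties
  using ( ≤-refl; ≤-trans; <⇒≤; <-irrefl; ≤-<-trans; <-≤-trans; _<?_; ≮⇒≥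
        ; +-assoc; +-comm; +-identityˡ; +-identityʳ; +-inverseˡ; +-inverseʳ; *-zeroˡ; *-zeroʳ
        ; +-mono-<-≤; +-monoˡ-<; +-monoˡ-≤; *-monoˡ-≤-nonNeg; *-monoʳ-≤-nonNeg; *-monoʳ-<-pos
        ; *-cancelˡ-<-nonNeg; neg-antimono-≤
        ; ⊓-sel; ⊔-sel; p⊓q≤p; p⊓q≤q; p≤p⊔q; p≤q⊔p; +-*-commutativeRing)
  renaming (_≟_ to _≟ℚ_)
open import Data.Sum as Sum using (_⊎_; inj₁; inj₂)
open import Function using (_∘_)
open import Induction.WellFounded as WF using ()
open import Level using (0ℓ)
open import Relation.Binary.Construct.On as On using ()
open import Relation.Binary.PropositionalEquality
  using (_≡_; _≢_; refl; sym; trans; cong; cong₂; subst; subst₂; module ≡-Reasoning)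
open import Relation.Nullary using (¬_; Dec; yes; no; ¬?)
open import Relation.Nullary.Decidable using (dec⇒maybe; from-yes)
open import Tactic.RingSolver using (solve-∀)
open import Tactic.RingSolver.Core.AlmostCommutativeRing using (AlmostCommutativeRing; fromCommutativeRing)

ℚ-ring : AlmostCommutativeRing 0ℓ 0ℓ
ℚ-ring = fromCommutativeRing +-*-commutativeRing (λ x → dec⇒maybe (0ℚ ≟ℚ x))

fromℕ : ℕ → ℚ
fromℕ zero    = 0ℚ
fromℕ (suc n) = 1ℚ + fromℕ n

0<1 : 0ℚ < 1ℚ
0<1 = from-yes (0ℚ <? 1ℚ)

0<p+q : ∀ {p q} → 0ℚ < p → 0ℚ ≤ q → 0ℚ < p + q
0<p+q {p} {q} 0<p 0≤q = subst (_< p + q) (+-identityʳ 0ℚ) (+-mono-<-≤ 0<p 0≤q)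

0<p*q : ∀ {p q} → 0ℚ < p → 0ℚ < q → 0ℚ < p * q
0<p*q {p} {q} 0<p 0<q = subst (_< p * q) (*-zeroʳ p) (*-monoʳ-<-pos p {{positive 0<p}} 0<q)

0≤p*q : ∀ {p q} → 0ℚ ≤ p → 0ℚ ≤ q → 0ℚ ≤ p * q
0≤p*q {p} {q} 0≤p 0≤q = subst (_≤ p * q) (*-zeroʳ p) (*-monoˡ-≤-nonNeg p {{nonNegative 0≤p}} 0≤q)

0≤fromℕ : ∀ n → 0ℚ ≤ fromℕ n
0≤fromℕ zero    = ≤-refl
0≤fromℕ (suc n) = <⇒≤ (0<p+q 0<1 (0≤fromℕ n))

0<fromℕ-suc : ∀ n → 0ℚ < fromℕ (suc n)
0<fromℕ-suc n = 0<p+q 0<1 (0≤fromℕ n)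

p<q⇒0<q-p : ∀ {p q} → p < q → 0ℚ < q - p
p<q⇒0<q-p {p} {q} p<q = subst (_< q - p) (+-inverseʳ p) (+-monoˡ-< (- p) p<q)

0<q-p⇒p<q : ∀ {p q} → 0ℚ < q - p → p < q
0<q-p⇒p<q {p} {q} 0<q-p = subst₂ _<_ (+-identityˡ p) (q-p+p≡q p q) (+-monoˡ-< p 0<q-p)
  where
  q-p+p≡q : ∀ p q → q - p + p ≡ q
  q-p+p≡q = solve-∀ ℚ-ring

<-by-difference : ∀ {a b c d} → a < b → b - a ≡ d - c → c < d
<-by-difference a<b eq = 0<q-p⇒p<q (subst (0ℚ <_) eq (p<q⇒0<q-p a<b))

0<p+q⇒-q<p : ∀ {p q} → 0ℚ < p + q → - q < p
0<p+q⇒-q<p {p} {q} 0<p+q = <-by-difference 0<p+q (difference p q)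
  where
  difference : ∀ p q → p + q - 0ℚ ≡ p - - q
  difference = solve-∀ ℚ-ring

0≤-p*q : ∀ {p q} → 0ℚ < p → q ≤ 0ℚ → 0ℚ ≤ - (p * q)
0≤-p*q {p} {q} 0<p q≤0 =
  neg-antimono-≤ (subst (p * q ≤_) (*-zeroʳ p) (*-monoˡ-≤-nonNeg p {{nonNegative (<⇒≤ 0<p)}} q≤0))

*-mono-<-nonNeg : ∀ {a b c d} → 0ℚ ≤ a → a < b → 0ℚ ≤ c → c < d → a * c < b * d
*-mono-<-nonNeg {a} {b} {c} 0≤a a<b 0≤c c<d =
  ≤-<-trans (*-monoʳ-≤-nonNeg c {{nonNegative 0≤c}} (<⇒≤ a<b))
            (*-monoʳ-<-pos b {{positive (≤-<-trans 0≤a a<b)}} c<d)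

record PositiveSolution (α β γ δ : ℚ) : Set where
  field
    μ ν     : ℚ
    0<μ     : 0ℚ < μ
    0<ν     : 0ℚ < ν
    0<μα+νβ : 0ℚ < μ * α + ν * β
    0<μγ+νδ : 0ℚ < μ * γ + ν * δ

-- With a = M α, b = M β, c = N γ, d = N δ the weights are μ = d - b and
-- ν = a - c, and both combinations equal a multiple of α δ - β γ, which is
-- positive because a > - c ≥ 0 and d > - b ≥ 0.
positiveSolution : ∀ {α β γ δ M N} → β ≤ 0ℚ → γ ≤ 0ℚ → 0ℚ < M → 0ℚ < N
                 → 0ℚ < M * α + N * γ → 0ℚ < M * β + N * δ → PositiveSolution α β γ δ
positiveSolution {α} {β} {γ} {δ} {M} {N} β≤0 γ≤0 0<M 0<N 0<Mα+Nγ 0<Mβ+Nδ = record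
  { μ = N * δ - M * β
  ; ν = M * α - N * γ
  ; 0<μ = 0<p+q 0<Nδ 0≤-Mβ
  ; 0<ν = 0<p+q 0<Mα 0≤-Nγ
  ; 0<μα+νβ = subst (0ℚ <_) (sym (first M N α β γ δ)) (0<p*q 0<N 0<αδ-βγ)
  ; 0<μγ+νδ = subst (0ℚ <_) (sym (second M N α β γ δ)) (0<p*q 0<M 0<αδ-βγ)
  }
  where
  0≤-Nγ : 0ℚ ≤ - (N * γ)
  0≤-Nγ = 0≤-p*q 0<N γ≤0
  0≤-Mβ : 0ℚ ≤ - (M * β)
  0≤-Mβ = 0≤-p*q 0<M β≤0
  -Nγ<Mα : - (N * γ) < M * α
  -Nγ<Mα = 0<p+q⇒-q<p 0<Mα+Nγ
  -Mβ<Nδ : - (M * β) < N * δ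
  -Mβ<Nδ = 0<p+q⇒-q<p (subst (0ℚ <_) (+-comm (M * β) (N * δ)) 0<Mβ+Nδ)
  0<Mα : 0ℚ < M * α
  0<Mα = ≤-<-trans 0≤-Nγ -Nγ<Mα
  0<Nδ : 0ℚ < N * δ
  0<Nδ = ≤-<-trans 0≤-Mβ -Mβ<Nδ
  determinant : ∀ M N α β γ δ → M * α * (N * δ) - - (N * γ) * - (M * β) ≡ M * N * (α * δ - β * γ)
  determinant = solve-∀ ℚ-ring
  first : ∀ M N α β γ δ → (N * δ - M * β) * α + (M * α - N * γ) * β ≡ N * (α * δ - β * γ)
  first = solve-∀ ℚ-ring
  second : ∀ M N α β γ δ → (N * δ - M * β) * γ + (M * α - N * γ) * δ ≡ M * (α * δ - β * γ)
  second = solve-∀ ℚ-ring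
  0<αδ-βγ : 0ℚ < α * δ - β * γ
  0<αδ-βγ = *-cancelˡ-<-nonNeg (M * N) {{nonNegative (<⇒≤ (0<p*q 0<M 0<N))}}
    (subst₂ _<_ (sym (*-zeroʳ (M * N))) (determinant M N α β γ δ)
      (p<q⇒0<q-p (*-mono-<-nonNeg 0≤-Nγ -Nγ<Mα 0≤-Mβ -Mβ<Nδ)))

Falsifies : Valuation → Sequent → Set
Falsifies v (Γ , Δ) = sumV v Δ < sumV v Γ

Countermodel : Hypersequent → Set
Countermodel G = Σ Valuation λ v → All (Falsifies v) G

Decided : Var → Hypersequent → Set
Decided q G = ⊢[ q ] G ⊎ Countermodel G

valid⇒¬countermodel : ∀ {G} → Valid G → ¬ Countermodel G
valid⇒¬countermodel valid (v , falsified) =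
  All¬⇒¬Any (All.map (λ ΣΔ<ΣΓ ΣΓ≤ΣΔ → <-irrefl refl (≤-<-trans ΣΓ≤ΣΔ ΣΔ<ΣΓ)) falsified) (valid v)

sumV-++ : ∀ v Γ Δ → sumV v (Γ ++ Δ) ≡ sumV v Γ + sumV v Δ
sumV-++ v []      Δ = sym (+-identityˡ (sumV v Δ))
sumV-++ v (A ∷ Γ) Δ =
  trans (cong (⟦ A ⟧ v +_) (sumV-++ v Γ Δ)) (sym (+-assoc (⟦ A ⟧ v) (sumV v Γ) (sumV v Δ)))

sumV-↭ : ∀ v {Γ Δ} → Γ ↭ Δ → sumV v Γ ≡ sumV v Δ
sumV-↭ v ↭.refl          = refl
sumV-↭ v (↭.prep A π)    = cong (⟦ A ⟧ v +_) (sumV-↭ v π)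
sumV-↭ v (↭.swap A B π)  = swapped (⟦ A ⟧ v) (⟦ B ⟧ v) _ _ (sumV-↭ v π)
  where
  swapped : ∀ a b x y → x ≡ y → a + (b + x) ≡ b + (a + y)
  swapped a b x y refl = trans (sym (+-assoc a b x)) (trans (cong (_+ x) (+-comm a b)) (+-assoc b a x))
sumV-↭ v (↭.trans π₁ π₂) = trans (sumV-↭ v π₁) (sumV-↭ v π₂)

falsifies-↭ : ∀ {v Γ Δ Γ′ Δ′} → Γ ↭ Γ′ → Δ ↭ Δ′ → Falsifies v (Γ , Δ) → Falsifies v (Γ′ , Δ′)
falsifies-↭ {v} πΓ πΔ = subst₂ _<_ (sumV-↭ v πΔ) (sumV-↭ v πΓ)

countermodel-resp-≈H : ∀ {G G′} → G ≈H G′ → Countermodel G → Countermodel G′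
countermodel-resp-≈H (_ , π , pointwise) (v , falsified) = v , transport pointwise (All-resp-↭ π falsified)
  where
  transport : ∀ {H H′} → Pointwise _≈S_ H H′ → All (Falsifies v) H → All (Falsifies v) H′
  transport []                      []       = []
  transport ((πΓ , πΔ) ∷ pointwise) (f ∷ fs) = falsifies-↭ πΓ πΔ f ∷ transport pointwise fs

decided-resp-≈H : ∀ {q G G′} → G ≈H G′ → Decided q G → Decided q G′
decided-resp-≈H G≈G′ (inj₁ d) = inj₁ (perm G≈G′ d)
decided-resp-≈H G≈G′ (inj₂ c) = inj₂ (countermodel-resp-≈H G≈G′ c)

≈S-refl : ∀ {S} → S ≈S S
≈S-refl = ↭-refl , ↭-refl

↭⇒≈H : ∀ {G G′} → G ↭ G′ → G ≈H G′
↭⇒≈H π = _ , π , Pointwise.refl ≈S-refl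

head-≈H : ∀ {Γ Δ Γ′ Δ′ G} → Γ ↭ Γ′ → Δ ↭ Δ′ → ((Γ , Δ) ∷ G) ≈H ((Γ′ , Δ′) ∷ G)
head-≈H πΓ πΔ = _ , ↭-refl , (πΓ , πΔ) ∷ Pointwise.refl ≈S-refl

⊬[] : ∀ {q} → ¬ (⊢[ q ] [])
⊬[] (perm (_ , G↭[] , []) d) with refl ← ↭-empty-inv G↭[] = ⊬[] d
⊬[] (shift _ _ d) = ⊬[] d

⊢-weaken : ∀ {q S G} H → ⊢[ q ] S ∷ G → ⊢[ q ] S ∷ G ++ H
⊢-weaken {G = G} []      d = subst (λ G′ → ⊢[ _ ] _ ∷ G′) (sym (++-identityʳ G)) d
⊢-weaken {S = S} {G} (T ∷ H) d =
  perm (↭⇒≈H (↭-trans (swap T S ↭-refl) (prep S (↭-sym (↭-shift T G H))))) (ew T (⊢-weaken H d))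

⊢-++ : ∀ {q G} H → ⊢[ q ] G → ⊢[ q ] G ++ H
⊢-++ {G = []}    H d = ⊥-elim (⊬[] d)
⊢-++ {G = _ ∷ _} H d = ⊢-weaken H d

⊢-identity : ∀ {q G} Γ → ⊢[ q ] (Γ , Γ) ∷ G
⊢-identity {G = G} []      = ⊢-weaken G ax∅
⊢-identity {G = G} (A ∷ Γ) = mix (⊢-weaken G (ax A)) (⊢-identity Γ)

AtomicSequent : Set
AtomicSequent = List Var × List Var

⌜_⌝ : AtomicSequent → Sequent
⌜ xs , ys ⌝ = map var xs , map var ys

sumVars : Valuation → List Var → ℚ
sumVars v xs = sumV v (map var xs)

excess : Valuation → AtomicSequent → ℚ
excess v (xs , ys) = sumVars v xs - sumVars v ys

AtomicCountermodel : List AtomicSequent → Set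
AtomicCountermodel Gs = Σ Valuation λ v → All (λ c → 0ℚ < excess v c) Gs

DecidedAtomic : Var → List AtomicSequent → Set
DecidedAtomic q Gs = ⊢[ q ] map ⌜_⌝ Gs ⊎ AtomicCountermodel Gs

decidedAtomic⇒decided : ∀ {q Gs} → DecidedAtomic q Gs → Decided q (map ⌜_⌝ Gs)
decidedAtomic⇒decided (inj₁ d)             = inj₁ d
decidedAtomic⇒decided (inj₂ (v , refuted)) = inj₂ (v , All-map⁺ (All.map 0<q-p⇒p<q refuted))

sumVars-++ : ∀ v xs ys → sumVars v (xs ++ ys) ≡ sumVars v xs + sumVars v ys
sumVars-++ v xs ys = trans (cong (sumV v) (map-++ var xs ys)) (sumV-++ v (map var xs) (map var ys))

sumVars-↭ : ∀ v {xs ys} → xs ↭ ys → sumVars v xs ≡ sumVars v ys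
sumVars-↭ v π = sumV-↭ v (map-↭⁺ var π)

1+p*q≡q+p*q : ∀ p q → (1ℚ + p) * q ≡ q + p * q
1+p*q≡q+p*q = solve-∀ ℚ-ring

sumVars-replicate : ∀ v n x → sumVars v (replicate n x) ≡ fromℕ n * v x
sumVars-replicate v zero    x = sym (*-zeroˡ (v x))
sumVars-replicate v (suc n) x =
  trans (cong (v x +_) (sumVars-replicate v n x)) (sym (1+p*q≡q+p*q (fromℕ n) (v x)))

copies : ℕ → List Var → List Var
copies m xs = concat (replicate m xs)

sumVars-copies : ∀ v m xs → sumVars v (copies m xs) ≡ fromℕ m * sumVars v xs
sumVars-copies v zero    xs = sym (*-zeroˡ (sumVars v xs))
sumVars-copies v (suc m) xs = begin
  sumVars v (xs ++ copies m xs)               ≡⟨ sumVars-++ v xs (copies m xs) ⟩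
  sumVars v xs + sumVars v (copies m xs)      ≡⟨ cong (sumVars v xs +_) (sumVars-copies v m xs) ⟩
  sumVars v xs + fromℕ m * sumVars v xs       ≡⟨ 1+p*q≡q+p*q (fromℕ m) (sumVars v xs) ⟨
  fromℕ (suc m) * sumVars v xs                ∎
  where open ≡-Reasoning

map-copies : ∀ m xs → map var (copies m xs) ≡ m · map var xs
map-copies m xs = trans (sym (concat-map (replicate m xs))) (cong concat (map-replicate (map var) m xs))

combine : ℚ → ℚ → Valuation → Valuation → Valuation
combine μ ν v w x = μ * v x + ν * w x

sumVars-combine : ∀ μ ν v w xs → sumVars (combine μ ν v w) xs ≡ μ * sumVars v xs + ν * sumVars w xs
sumVars-combine μ ν v w []       = sym (linear-zero μ ν)
  where
  linear-zero : ∀ μ ν → μ * 0ℚ + ν * 0ℚ ≡ 0ℚ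
  linear-zero = solve-∀ ℚ-ring
sumVars-combine μ ν v w (x ∷ xs) =
  trans (cong (combine μ ν v w x +_) (sumVars-combine μ ν v w xs))
        (linear-cons μ ν (v x) (w x) (sumVars v xs) (sumVars w xs))
  where
  linear-cons : ∀ μ ν a b s t → μ * a + ν * b + (μ * s + ν * t) ≡ μ * (a + s) + ν * (b + t)
  linear-cons = solve-∀ ℚ-ring

excess-combine : ∀ μ ν v w c → excess (combine μ ν v w) c ≡ μ * excess v c + ν * excess w c
excess-combine μ ν v w (xs , ys) =
  trans (cong₂ _-_ (sumVars-combine μ ν v w xs) (sumVars-combine μ ν v w ys))
        (linear-sub μ ν (sumVars v xs) (sumVars w xs) (sumVars v ys) (sumVars w ys))
  where
  linear-sub : ∀ μ ν a b c d → μ * a + ν * b - (μ * c + ν * d) ≡ μ * (a - c) + ν * (b - d)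
  linear-sub = solve-∀ ℚ-ring

refuted-combine : ∀ {μ ν v w} → 0ℚ < μ → 0ℚ < ν → ∀ {Gs}
                → All (λ c → 0ℚ < excess v c) Gs → All (λ c → 0ℚ < excess w c) Gs
                → All (λ c → 0ℚ < excess (combine μ ν v w) c) Gs
refuted-combine {μ} {ν} {v} {w} 0<μ 0<ν refuted-v refuted-w =
  All.zipWith (λ {c} → positive-cone {c}) (refuted-v , refuted-w)
  where
  positive-cone : ∀ {c} → 0ℚ < excess v c × 0ℚ < excess w c → 0ℚ < excess (combine μ ν v w) c
  positive-cone {c} (0<e , 0<e′) =
    subst (0ℚ <_) (sym (excess-combine μ ν v w c)) (0<p+q (0<p*q 0<μ 0<e) (<⇒≤ (0<p*q 0<ν 0<e′)))

_[_≔_] : Valuation → Var → ℚ → Valuation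
(v [ p ≔ a ]) x with p ℕ.≟ x
... | yes _ = a
... | no  _ = v x

update-≡ : ∀ v p a → (v [ p ≔ a ]) p ≡ a
update-≡ v p a with p ℕ.≟ p
... | yes _   = refl
... | no  p≢p = ⊥-elim (p≢p refl)

update-≢ : ∀ v {p x} a → p ≢ x → (v [ p ≔ a ]) x ≡ v x
update-≢ v {p} {x} a p≢x with p ℕ.≟ x
... | yes p≡x = ⊥-elim (p≢x p≡x)
... | no  _   = refl

sumVars-update-∉ : ∀ v {p} a {xs} → p ∉ xs → sumVars (v [ p ≔ a ]) xs ≡ sumVars v xs
sumVars-update-∉ v a {[]}     p∉xs = refl
sumVars-update-∉ v a {x ∷ xs} p∉xs =
  cong₂ _+_ (update-≢ v a (p∉xs ∘ here)) (sumVars-update-∉ v a (p∉xs ∘ there))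

Fresh : Var → AtomicSequent → Set
Fresh p (xs , ys) = p ∉ xs × p ∉ ys

excess-update-fresh : ∀ v {p} a c → Fresh p c → excess (v [ p ≔ a ]) c ≡ excess v c
excess-update-fresh v a (xs , ys) (p∉xs , p∉ys) =
  cong₂ _-_ (sumVars-update-∉ v a p∉xs) (sumVars-update-∉ v a p∉ys)

-- (c , k) stands for c with k + 1 further copies of the eliminated variable
-- on one side.
Surplus : Set
Surplus = AtomicSequent × ℕ

extraˡ extraʳ : Var → Surplus → AtomicSequent
extraˡ p ((xs , ys) , k) = xs ++ replicate (suc k) p , ys
extraʳ p ((xs , ys) , k) = xs , ys ++ replicate (suc k) p

sumVars-++-replicate : ∀ v xs n p → sumVars v (xs ++ replicate n p) ≡ sumVars v xs + fromℕ n * v p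
sumVars-++-replicate v xs n p =
  trans (sumVars-++ v xs (replicate n p)) (cong (sumVars v xs +_) (sumVars-replicate v n p))

excess-extraˡ : ∀ {p} v a L → Fresh p (proj₁ L)
              → excess (v [ p ≔ a ]) (extraˡ p L) ≡ excess v (proj₁ L) + fromℕ (suc (proj₂ L)) * a
excess-extraˡ {p} v a ((xs , ys) , k) (p∉xs , p∉ys) = begin
  sumVars v′ (xs ++ replicate (suc k) p) - sumVars v′ ys
    ≡⟨ cong₂ _-_ (sumVars-++-replicate v′ xs (suc k) p) (sumVars-update-∉ v a p∉ys) ⟩
  sumVars v′ xs + fromℕ (suc k) * v′ p - sumVars v ys
    ≡⟨ cong (λ z → z - sumVars v ys)
            (cong₂ (λ z a′ → z + fromℕ (suc k) * a′) (sumVars-update-∉ v a p∉xs) (update-≡ v p a)) ⟩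
  sumVars v xs + fromℕ (suc k) * a - sumVars v ys
    ≡⟨ rearrange (sumVars v xs) (fromℕ (suc k) * a) (sumVars v ys) ⟩
  sumVars v xs - sumVars v ys + fromℕ (suc k) * a ∎
  where
  open ≡-Reasoning
  v′ = v [ p ≔ a ]
  rearrange : ∀ x n y → x + n - y ≡ x - y + n
  rearrange = solve-∀ ℚ-ring

excess-extraʳ : ∀ {p} v a R → Fresh p (proj₁ R)
              → excess (v [ p ≔ - a ]) (extraʳ p R) ≡ excess v (proj₁ R) + fromℕ (suc (proj₂ R)) * a
excess-extraʳ {p} v a ((xs , ys) , k) (p∉xs , p∉ys) = begin
  sumVars v′ xs - sumVars v′ (ys ++ replicate (suc k) p)
    ≡⟨ cong₂ _-_ (sumVars-update-∉ v (- a) p∉xs) (sumVars-++-replicate v′ ys (suc k) p) ⟩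
  sumVars v xs - (sumVars v′ ys + fromℕ (suc k) * v′ p)
    ≡⟨ cong (λ z → sumVars v xs - z)
            (cong₂ (λ z a′ → z + fromℕ (suc k) * a′) (sumVars-update-∉ v (- a) p∉ys) (update-≡ v p (- a))) ⟩
  sumVars v xs - (sumVars v ys + fromℕ (suc k) * - a)
    ≡⟨ rearrange (sumVars v xs) (sumVars v ys) (fromℕ (suc k)) a ⟩
  sumVars v xs - sumVars v ys + fromℕ (suc k) * a ∎
  where
  open ≡-Reasoning
  v′ = v [ p ≔ - a ]
  rearrange : ∀ x y n a → x - (y + n * - a) ≡ x - y + n * a
  rearrange = solve-∀ ℚ-ring

combination : Surplus → Surplus → AtomicSequent
combination ((xs₁ , ys₁) , k) ((xs₂ , ys₂) , l) =
  copies (suc l) xs₁ ++ copies (suc k) xs₂ , copies (suc l) ys₁ ++ copies (suc k) ys₂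

excess-combination : ∀ v p L R → excess v (combination L R)
                   ≡ fromℕ (suc (proj₂ R)) * excess v (extraˡ p L) + fromℕ (suc (proj₂ L)) * excess v (extraʳ p R)
excess-combination v p ((xs₁ , ys₁) , k) ((xs₂ , ys₂) , l) = begin
  sumVars v (copies m xs₁ ++ copies n xs₂) - sumVars v (copies m ys₁ ++ copies n ys₂)
    ≡⟨ cong₂ _-_ (sum-of-copies xs₁ xs₂) (sum-of-copies ys₁ ys₂) ⟩
  M * X₁ + N * X₂ - (M * Y₁ + N * Y₂)
    ≡⟨ p-cancels M N X₁ X₂ Y₁ Y₂ (v p) ⟩
  M * (X₁ + N * v p - Y₁) + N * (X₂ - (Y₂ + M * v p))
    ≡⟨ cong₂ (λ x y → M * (x - Y₁) + N * (X₂ - y))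
             (sumVars-++-replicate v xs₁ n p) (sumVars-++-replicate v ys₂ m p) ⟨
  M * excess v (xs₁ ++ replicate n p , ys₁) + N * excess v (xs₂ , ys₂ ++ replicate m p) ∎
  where
  open ≡-Reasoning
  m = suc l
  n = suc k
  M = fromℕ m
  N = fromℕ n
  X₁ = sumVars v xs₁
  X₂ = sumVars v xs₂
  Y₁ = sumVars v ys₁
  Y₂ = sumVars v ys₂
  sum-of-copies : ∀ as bs → sumVars v (copies m as ++ copies n bs) ≡ M * sumVars v as + N * sumVars v bs
  sum-of-copies as bs =
    trans (sumVars-++ v (copies m as) (copies n bs)) (cong₂ _+_ (sumVars-copies v m as) (sumVars-copies v n bs))
  p-cancels : ∀ M N X₁ X₂ Y₁ Y₂ P
            → M * X₁ + N * X₂ - (M * Y₁ + N * Y₂) ≡ M * (X₁ + N * P - Y₁) + N * (X₂ - (Y₂ + M * P))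
  p-cancels = solve-∀ ℚ-ring

map-++-replicate : ∀ xs n p → map var (xs ++ replicate n p) ≡ map var xs ++ replicate n (var p)
map-++-replicate xs n p = trans (map-++ var xs (replicate n p)) (cong (map var xs ++_) (map-replicate var n p))

⌜extraˡ⌝ : ∀ p L → ⌜ extraˡ p L ⌝
         ≡ (map var (proj₁ (proj₁ L)) ++ replicate (suc (proj₂ L)) (var p) , map var (proj₂ (proj₁ L)))
⌜extraˡ⌝ p ((xs , ys) , k) = cong (_, map var ys) (map-++-replicate xs (suc k) p)

⌜extraʳ⌝ : ∀ p R → ⌜ extraʳ p R ⌝
         ≡ (map var (proj₁ (proj₁ R)) , map var (proj₂ (proj₁ R)) ++ replicate (suc (proj₂ R)) (var p))
⌜extraʳ⌝ p ((xs , ys) , k) = cong (map var xs ,_) (map-++-replicate ys (suc k) p)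

⌜combination⌝ : ∀ L R → ⌜ combination L R ⌝
  ≡ ( suc (proj₂ R) · map var (proj₁ (proj₁ L)) ++ suc (proj₂ L) · map var (proj₁ (proj₁ R))
    , suc (proj₂ R) · map var (proj₂ (proj₁ L)) ++ suc (proj₂ L) · map var (proj₂ (proj₁ R)))
⌜combination⌝ ((xs₁ , ys₁) , k) ((xs₂ , ys₂) , l) = cong₂ _,_ (copies-map xs₁ xs₂) (copies-map ys₁ ys₂)
  where
  copies-map : ∀ as bs → map var (copies (suc l) as ++ copies (suc k) bs) ≡ suc l · map var as ++ suc k · map var bs
  copies-map as bs =
    trans (map-++ var (copies (suc l) as) _) (cong₂ _++_ (map-copies (suc l) as) (map-copies (suc k) bs))

atomic-vars : ∀ xs → Atomic (map var xs)
atomic-vars xs = All-map⁺ (All.universal (λ x → x , refl) xs)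

∉⇒¬occurs : ∀ {p xs} → p ∉ xs → ¬ OccursL p (map var xs)
∉⇒¬occurs p∉xs = p∉xs ∘ Any-map⁻

⊢-resolve : ∀ {p Rest} L R → Fresh p (proj₁ L) → Fresh p (proj₁ R)
          → ∀ S → S ≡ extraˡ p L ⊎ S ≡ extraʳ p R
          → ⊢[ p ] ⌜ combination L R ⌝ ∷ ⌜ S ⌝ ∷ Rest → ⊢[ p ] ⌜ extraˡ p L ⌝ ∷ ⌜ extraʳ p R ⌝ ∷ Rest
⊢-resolve {p} {Rest} L@((xs₁ , ys₁) , k) R@((xs₂ , ys₂) , l) (p∉xs₁ , p∉ys₁) (p∉xs₂ , p∉ys₂) S S≡ d =
  subst₂ (λ A B → ⊢[ p ] A ∷ B ∷ Rest) (sym (⌜extraˡ⌝ p L)) (sym (⌜extraʳ⌝ p R))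
    (S′ (atomic-vars xs₁) (atomic-vars ys₁) (atomic-vars xs₂) (atomic-vars ys₂) (ℕ.s≤s ℕ.z≤n) (ℕ.s≤s ℕ.z≤n)
        (∉⇒¬occurs p∉xs₁) (∉⇒¬occurs p∉ys₁) (∉⇒¬occurs p∉xs₂) (∉⇒¬occurs p∉ys₂) ⌜ S ⌝
        (Sum.map (λ e → trans (cong ⌜_⌝ e) (⌜extraˡ⌝ p L)) (λ e → trans (cong ⌜_⌝ e) (⌜extraʳ⌝ p R)) S≡)
        (subst (λ C → ⊢[ p ] C ∷ ⌜ S ⌝ ∷ Rest) (⌜combination⌝ L R) d))

-- Unless one of the two valuations already refutes both extra components,
-- the four excesses have the signs required by positiveSolution, and its
-- remaining hypotheses are the two refutations of the combination.
combine-countermodels : ∀ {p} L R Rest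
  → AtomicCountermodel (combination L R ∷ extraˡ p L ∷ Rest)
  → AtomicCountermodel (combination L R ∷ extraʳ p R ∷ Rest)
  → AtomicCountermodel (extraˡ p L ∷ extraʳ p R ∷ Rest)
combine-countermodels {p} L R Rest (v , 0<C-v ∷ 0<L-v ∷ rest-v) (w , 0<C-w ∷ 0<R-w ∷ rest-w)
  with 0ℚ <? excess v (extraʳ p R) | 0ℚ <? excess w (extraˡ p L)
... | yes 0<R-v | _         = v , 0<L-v ∷ 0<R-v ∷ rest-v
... | no _      | yes 0<L-w = w , 0<L-w ∷ 0<R-w ∷ rest-w
... | no 0≮R-v  | no 0≮L-w  =
  combine μ ν v w
  , refuted (extraˡ p L) 0<μα+νβ ∷ refuted (extraʳ p R) 0<μγ+νδ ∷ refuted-combine 0<μ 0<ν rest-v rest-w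
  where
  solution : PositiveSolution (excess v (extraˡ p L)) (excess w (extraˡ p L))
                              (excess v (extraʳ p R)) (excess w (extraʳ p R))
  solution = positiveSolution (≮⇒≥ 0≮L-w) (≮⇒≥ 0≮R-v) (0<fromℕ-suc (proj₂ R)) (0<fromℕ-suc (proj₂ L))
    (subst (0ℚ <_) (excess-combination v p L R) 0<C-v) (subst (0ℚ <_) (excess-combination w p L R) 0<C-w)
  open PositiveSolution solution
  refuted : ∀ c → 0ℚ < μ * excess v c + ν * excess w c → 0ℚ < excess (combine μ ν v w) c
  refuted c = subst (0ℚ <_) (sym (excess-combine μ ν v w c))

resolve : ∀ {p} L R Rest → Fresh p (proj₁ L) → Fresh p (proj₁ R)
        → DecidedAtomic p (combination L R ∷ extraˡ p L ∷ Rest)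
        → DecidedAtomic p (combination L R ∷ extraʳ p R ∷ Rest)
        → DecidedAtomic p (extraˡ p L ∷ extraʳ p R ∷ Rest)
resolve L R Rest freshL freshR (inj₁ d) _        = inj₁ (⊢-resolve L R freshL freshR _ (inj₁ refl) d)
resolve L R Rest freshL freshR (inj₂ _) (inj₁ d) = inj₁ (⊢-resolve L R freshL freshR _ (inj₂ refl) d)
resolve L R Rest _      _      (inj₂ c) (inj₂ c′) = inj₂ (combine-countermodels L R Rest c c′)

bound : Valuation → List AtomicSequent → ℚ
bound v []       = 0ℚ
bound v (c ∷ cs) = (- excess v c) ⊔ bound v cs

0≤bound : ∀ v cs → 0ℚ ≤ bound v cs
0≤bound v []       = ≤-refl
0≤bound v (c ∷ cs) = ≤-trans (0≤bound v cs) (p≤q⊔p (- excess v c) (bound v cs))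

-excess≤bound : ∀ v cs → All (λ c → - excess v c ≤ bound v cs) cs
-excess≤bound v []       = []
-excess≤bound v (c ∷ cs) =
  p≤p⊔q (- excess v c) (bound v cs)
  ∷ All.map (λ h → ≤-trans h (p≤q⊔p (- excess v c) (bound v cs))) (-excess≤bound v cs)

0<e+[1+k]*[1+B] : ∀ {e B} k → - e ≤ B → 0ℚ ≤ B → 0ℚ < e + fromℕ (suc k) * (1ℚ + B)
0<e+[1+k]*[1+B] {e} {B} k -e≤B 0≤B =
  subst (0ℚ <_) (sym (regroup e B (fromℕ k)))
    (0<p+q (0<p+q 0<1 (subst (_≤ B + e) (+-inverseˡ e) (+-monoˡ-≤ e -e≤B)))
           (0≤p*q (0≤fromℕ k) (<⇒≤ (0<p+q 0<1 0≤B))))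
  where
  regroup : ∀ e B n → e + (1ℚ + n) * (1ℚ + B) ≡ 1ℚ + (B + e) + n * (1ℚ + B)
  regroup = solve-∀ ℚ-ring

extend : ∀ {p} (shape : Surplus → AtomicSequent) (place : ℚ → ℚ)
       → (∀ v a S → Fresh p (proj₁ S)
            → excess (v [ p ≔ place a ]) (shape S) ≡ excess v (proj₁ S) + fromℕ (suc (proj₂ S)) * a)
       → ∀ Fs Ss → All (Fresh p) Fs → All (Fresh p ∘ proj₁) Ss
       → DecidedAtomic p Fs → DecidedAtomic p (Fs ++ map shape Ss)
extend shape place excess-shape Fs Ss _ _ (inj₁ d) =
  inj₁ (subst (⊢[ _ ]_) (sym (map-++ ⌜_⌝ Fs (map shape Ss))) (⊢-++ _ d))
extend {p} shape place excess-shape Fs Ss freshFs freshSs (inj₂ (v , refutedFs)) =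
  inj₂ (v′ , ++⁺ (All.zipWith (λ {c} → keep {c}) (freshFs , refutedFs))
                 (All-map⁺ (All.zipWith (λ {S} → raise {S})
                                        (freshSs , All-map⁻ (-excess≤bound v (map proj₁ Ss))))))
  where
  B = bound v (map proj₁ Ss)
  v′ = v [ p ≔ place (1ℚ + B) ]
  keep : ∀ {c} → Fresh p c × 0ℚ < excess v c → 0ℚ < excess v′ c
  keep {c} (fresh , 0<e) = subst (0ℚ <_) (sym (excess-update-fresh v (place (1ℚ + B)) c fresh)) 0<e
  raise : ∀ {S} → Fresh p (proj₁ S) × - excess v (proj₁ S) ≤ B → 0ℚ < excess v′ (shape S)
  raise {S} (fresh , -e≤B) =
    subst (0ℚ <_) (sym (excess-shape v (1ℚ + B) S fresh))
          (0<e+[1+k]*[1+B] (proj₂ S) -e≤B (0≤bound v (map proj₁ Ss)))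

Over : List Var → AtomicSequent → Set
Over V (xs , ys) = All (_∈ V) xs × All (_∈ V) ys

over⇒fresh : ∀ {p V} c → p ∉ V → Over V c → Fresh p c
over⇒fresh _ p∉V (xs⊆V , ys⊆V) = p∉V ∘ All.lookup xs⊆V , p∉V ∘ All.lookup ys⊆V

_≢?_ : ∀ (p x : Var) → Dec (p ≢ x)
p ≢? x = ¬? (p ℕ.≟ x)

_∖_ : List Var → Var → List Var
V ∖ p = filter (p ≢?_) V

∖-shorter : ∀ {p V} → p ∈ V → length (V ∖ p) ℕ.< length V
∖-shorter {p} {V} p∈V = filter-notAll (p ≢?_) V (Any.map (λ p≡x p≢x → p≢x p≡x) p∈V)

∉∖ : ∀ p V → p ∉ V ∖ p
∉∖ p V p∈V∖p = proj₂ (∈-filter⁻ (p ≢?_) {xs = V} p∈V∖p) refl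

record Separation (p : Var) (W : List Var) (xs : List Var) : Set where
  constructor separation
  field
    others      : List Var
    count       : ℕ
    others-over : All (_∈ W) others
    separated   : xs ↭ others ++ replicate count p

separate : ∀ p {V} xs → All (_∈ V) xs → Separation p (V ∖ p) xs
separate p []       []             = separation [] 0 [] ↭-refl
separate p (x ∷ xs) (x∈V ∷ xs⊆V) with separate p xs xs⊆V | p ℕ.≟ x
... | separation os n os⊆ π | yes refl =
  separation os (suc n) os⊆ (↭-trans (prep p π) (↭-sym (↭-shift p os (replicate n p))))
... | separation os n os⊆ π | no p≢x =
  separation (x ∷ os) n (∈-filter⁺ (p ≢?_) x∈V p≢x ∷ os⊆) (prep x π)

decidedAtomic-↭ : ∀ {q Gs Hs} → Gs ↭ Hs → DecidedAtomic q Gs → DecidedAtomic q Hs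
decidedAtomic-↭ π (inj₁ d)             = inj₁ (perm (↭⇒≈H (map-↭⁺ ⌜_⌝ π)) d)
decidedAtomic-↭ π (inj₂ (v , refuted)) = inj₂ (v , All-resp-↭ π refuted)

Reduces : Var → AtomicSequent → AtomicSequent → Set
Reduces q c′ c = ∀ {Gs} → DecidedAtomic q (c′ ∷ Gs) → DecidedAtomic q (c ∷ Gs)

reduces-by-cancelling : ∀ {q xs ys xs′ ys′ zs} → xs ↭ xs′ ++ zs → ys ↭ ys′ ++ zs
                      → Reduces q (xs′ , ys′) (xs , ys)
reduces-by-cancelling {q} {xs} {ys} {xs′} {ys′} {zs} πx πy = permute ∘ cancel
  where
  cancel : ∀ {Gs} → DecidedAtomic q ((xs′ , ys′) ∷ Gs) → DecidedAtomic q ((xs′ ++ zs , ys′ ++ zs) ∷ Gs)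
  cancel (inj₁ d) =
    inj₁ (subst (λ C → ⊢[ q ] C ∷ _) (sym (cong₂ _,_ (map-++ var xs′ zs) (map-++ var ys′ zs)))
                (mix d (⊢-identity (map var zs))))
  cancel {Gs} (inj₂ (v , 0<e ∷ refuted)) = inj₂ (v , subst (0ℚ <_) (sym same-excess) 0<e ∷ refuted)
    where
    difference : ∀ a b c → a + c - (b + c) ≡ a - b
    difference = solve-∀ ℚ-ring
    same-excess : excess v (xs′ ++ zs , ys′ ++ zs) ≡ excess v (xs′ , ys′)
    same-excess = trans (cong₂ _-_ (sumVars-++ v xs′ zs) (sumVars-++ v ys′ zs))
                        (difference (sumVars v xs′) (sumVars v ys′) (sumVars v zs))
  permute : ∀ {Gs} → DecidedAtomic q ((xs′ ++ zs , ys′ ++ zs) ∷ Gs) → DecidedAtomic q ((xs , ys) ∷ Gs)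
  permute (inj₁ d) = inj₁ (perm (head-≈H (map-↭⁺ var (↭-sym πx)) (map-↭⁺ var (↭-sym πy))) d)
  permute (inj₂ (v , 0<e ∷ refuted)) =
    inj₂ (v , subst (0ℚ <_) (cong₂ _-_ (sumVars-↭ v (↭-sym πx)) (sumVars-↭ v (↭-sym πy))) 0<e ∷ refuted)

data Normal (p : Var) (W : List Var) (c : AtomicSequent) : Set where
  free     : ∀ c′ → Over W c′ → Reduces p c′ c → Normal p W c
  surplusˡ : ∀ L → Over W (proj₁ L) → Reduces p (extraˡ p L) c → Normal p W c
  surplusʳ : ∀ R → Over W (proj₁ R) → Reduces p (extraʳ p R) c → Normal p W c

replicate-+ : ∀ {A : Set} m n (x : A) → replicate (m ℕ.+ n) x ≡ replicate m x ++ replicate n x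
replicate-+ zero    n x = refl
replicate-+ (suc m) n x = cong (x ∷_) (replicate-+ m n x)

surplus-↭ : ∀ (zs : List Var) a d x
          → zs ++ replicate (suc (a ℕ.+ d)) x ↭ (zs ++ replicate (suc d) x) ++ replicate a x
surplus-↭ zs a d x =
  ↭-trans (++⁺ˡ zs (prep x (↭-trans (↭-reflexive (replicate-+ a d x)) (++-comm (replicate a x) (replicate d x)))))
          (↭-reflexive (sym (++-assoc zs (replicate (suc d) x) (replicate a x))))

normalise : ∀ p {V} c → Over V c → Normal p (V ∖ p) c
normalise p (xs , ys) (xs⊆V , ys⊆V) with separate p xs xs⊆V | separate p ys ys⊆V
... | separation xs′ a xs′⊆ πx | separation ys′ b ys′⊆ πy with compare a b
...   | less a d    = surplusʳ ((xs′ , ys′) , d) (xs′⊆ , ys′⊆)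
                        (reduces-by-cancelling πx (↭-trans πy (surplus-↭ ys′ a d p)))
...   | equal a     = free (xs′ , ys′) (xs′⊆ , ys′⊆) (reduces-by-cancelling πx πy)
...   | greater b d = surplusˡ ((xs′ , ys′) , d) (xs′⊆ , ys′⊆)
                        (reduces-by-cancelling (↭-trans πx (surplus-↭ xs′ b d p)) πy)

sorted : Var → List AtomicSequent → List Surplus → List Surplus → List AtomicSequent
sorted p Fs Ls Rs = Fs ++ map (extraˡ p) Ls ++ map (extraʳ p) Rs

sorted-↭ˡ : ∀ p Fs L Ls Rs → sorted p Fs (L ∷ Ls) Rs ↭ extraˡ p L ∷ sorted p Fs Ls Rs
sorted-↭ˡ p Fs L Ls Rs = ↭-shift (extraˡ p L) Fs _

sorted-↭ʳ : ∀ p Fs Ls R Rs → sorted p Fs Ls (R ∷ Rs) ↭ extraʳ p R ∷ sorted p Fs Ls Rs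
sorted-↭ʳ p Fs Ls R Rs =
  ↭-trans (++⁺ˡ Fs (↭-shift (extraʳ p R) (map (extraˡ p) Ls) _)) (↭-shift (extraʳ p R) Fs _)

record Normalised (p : Var) (W : List Var) (Gs : List AtomicSequent) : Set where
  field
    frees       : List AtomicSequent
    lefts       : List Surplus
    rights      : List Surplus
    frees-over  : All (Over W) frees
    lefts-over  : All (Over W ∘ proj₁) lefts
    rights-over : All (Over W ∘ proj₁) rights
    reduces     : ∀ Hs → DecidedAtomic p (sorted p frees lefts rights ++ Hs) → DecidedAtomic p (Gs ++ Hs)

reduces-∷ : ∀ {p W Gs c c′} (N : Normalised p W Gs) {Xs} → Reduces p c′ c
          → Xs ↭ c′ ∷ sorted p (Normalised.frees N) (Normalised.lefts N) (Normalised.rights N)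
          → ∀ Hs → DecidedAtomic p (Xs ++ Hs) → DecidedAtomic p (c ∷ Gs ++ Hs)
reduces-∷ {Gs = Gs} {c′ = c′} N red π Hs =
  red ∘ decidedAtomic-↭ (↭-shift c′ Gs Hs) ∘ reduces (c′ ∷ Hs)
      ∘ decidedAtomic-↭ (↭-trans (++⁺ʳ Hs π) (↭-sym (↭-shift c′ (sorted _ frees lefts rights) Hs)))
  where open Normalised N

normaliseAll : ∀ p {V} Gs → All (Over V) Gs → Normalised p (V ∖ p) Gs
normaliseAll p [] [] = record
  { frees = [] ; lefts = [] ; rights = []
  ; frees-over = [] ; lefts-over = [] ; rights-over = []
  ; reduces = λ _ d → d }
normaliseAll p (c ∷ Gs) (c⊆V ∷ Gs⊆V) with normaliseAll p Gs Gs⊆V | normalise p c c⊆V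
... | N | free c′ c′⊆ red = record
  { frees = c′ ∷ frees ; lefts = lefts ; rights = rights
  ; frees-over = c′⊆ ∷ frees-over ; lefts-over = lefts-over ; rights-over = rights-over
  ; reduces = reduces-∷ N red ↭-refl }
  where open Normalised N
... | N | surplusˡ L L⊆ red = record
  { frees = frees ; lefts = L ∷ lefts ; rights = rights
  ; frees-over = frees-over ; lefts-over = L⊆ ∷ lefts-over ; rights-over = rights-over
  ; reduces = reduces-∷ N red (sorted-↭ˡ p frees L lefts rights) }
  where open Normalised N
... | N | surplusʳ R R⊆ red = record
  { frees = frees ; lefts = lefts ; rights = R ∷ rights
  ; frees-over = frees-over ; lefts-over = lefts-over ; rights-over = R⊆ ∷ rights-over
  ; reduces = reduces-∷ N red (sorted-↭ʳ p frees lefts R rights) }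
  where open Normalised N

over-combination : ∀ {W} L R → Over W (proj₁ L) → Over W (proj₁ R) → Over W (combination L R)
over-combination {W} ((xs₁ , ys₁) , k) ((xs₂ , ys₂) , l) (xs₁⊆ , ys₁⊆) (xs₂⊆ , ys₂⊆) =
    ++⁺ (copies⁺ (suc l) xs₁⊆) (copies⁺ (suc k) xs₂⊆)
  , ++⁺ (copies⁺ (suc l) ys₁⊆) (copies⁺ (suc k) ys₂⊆)
  where
  copies⁺ : ∀ m {zs} → All (_∈ W) zs → All (_∈ W) (copies m zs)
  copies⁺ m zs⊆ = concat⁺ (replicate⁺ m zs⊆)

-- Each (S′) step trades a pair of surplus components for a p-free
-- combination, so the recursion ends with surpluses on one side only.
eliminate : ∀ {p W} → p ∉ W → (∀ Gs → All (Over W) Gs → DecidedAtomic p Gs)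
          → ∀ Fs Ls Rs → All (Over W) Fs → All (Over W ∘ proj₁) Ls → All (Over W ∘ proj₁) Rs
          → DecidedAtomic p (sorted p Fs Ls Rs)
eliminate p∉W decide Fs [] Rs Fs⊆ _ Rs⊆ =
  extend (extraʳ _) -_ excess-extraʳ Fs Rs
    (All.map (over⇒fresh _ p∉W) Fs⊆) (All.map (over⇒fresh _ p∉W) Rs⊆) (decide Fs Fs⊆)
eliminate p∉W decide Fs Ls@(_ ∷ _) [] Fs⊆ Ls⊆ _ =
  subst (DecidedAtomic _) (cong (Fs ++_) (sym (++-identityʳ _)))
    (extend (extraˡ _) (λ a → a) excess-extraˡ Fs Ls
      (All.map (over⇒fresh _ p∉W) Fs⊆) (All.map (over⇒fresh _ p∉W) Ls⊆) (decide Fs Fs⊆))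
eliminate {p} p∉W decide Fs (L ∷ Ls) (R ∷ Rs) Fs⊆ (L⊆ ∷ Ls⊆) (R⊆ ∷ Rs⊆) =
  decidedAtomic-↭ (↭-sym (↭-trans (sorted-↭ˡ p Fs L Ls (R ∷ Rs)) (prep _ (sorted-↭ʳ p Fs Ls R Rs))))
    (resolve L R (sorted p Fs Ls Rs) (over⇒fresh _ p∉W L⊆) (over⇒fresh _ p∉W R⊆)
      (decidedAtomic-↭ (prep _ (sorted-↭ˡ p Fs L Ls Rs))
        (eliminate p∉W decide (C ∷ Fs) (L ∷ Ls) Rs (C⊆ ∷ Fs⊆) (L⊆ ∷ Ls⊆) Rs⊆))
      (decidedAtomic-↭ (prep _ (sorted-↭ʳ p Fs Ls R Rs))
        (eliminate p∉W decide (C ∷ Fs) Ls (R ∷ Rs) (C⊆ ∷ Fs⊆) Ls⊆ (R⊆ ∷ Rs⊆))))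
  where
  C = combination L R
  C⊆ = over-combination L R L⊆ R⊆

eliminateVar : ∀ {p V} → (∀ Gs → All (Over (V ∖ p)) Gs → DecidedAtomic p Gs)
             → ∀ Gs → All (Over V) Gs → DecidedAtomic p Gs
eliminateVar {p} {V} decide Gs Gs⊆V =
  subst (DecidedAtomic p) (++-identityʳ Gs)
    (reduces [] (subst (DecidedAtomic p) (sym (++-identityʳ _))
      (eliminate (∉∖ p V) decide frees lefts rights frees-over lefts-over rights-over)))
  where open Normalised (normaliseAll p Gs Gs⊆V)

vars : List AtomicSequent → List Var
vars []               = []
vars ((xs , ys) ∷ Gs) = xs ++ ys ++ vars Gs

over-vars : ∀ Gs → All (Over (vars Gs)) Gs
over-vars []               = []
over-vars ((xs , ys) ∷ Gs) =
  (All.tabulate ∈-++⁺ˡ , All.tabulate (∈-++⁺ʳ xs ∘ ∈-++⁺ˡ))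
  ∷ All.map (λ { (xs⊆ , ys⊆) → All.map inVars xs⊆ , All.map inVars ys⊆ }) (over-vars Gs)
  where
  inVars : ∀ {x} → x ∈ vars Gs → x ∈ xs ++ ys ++ vars Gs
  inVars = ∈-++⁺ʳ xs ∘ ∈-++⁺ʳ ys

vars⊆ : ∀ {V x} Gs → All (Over V) Gs → x ∈ vars Gs → x ∈ V
vars⊆ ((xs , ys) ∷ Gs) ((xs⊆ , ys⊆) ∷ Gs⊆) x∈ with ∈-++⁻ xs x∈
... | inj₁ x∈xs = All.lookup xs⊆ x∈xs
... | inj₂ x∈ys++ with ∈-++⁻ ys x∈ys++
...   | inj₁ x∈ys   = All.lookup ys⊆ x∈ys
...   | inj₂ x∈vars = vars⊆ Gs Gs⊆ x∈vars

∈vars⇒occurs : ∀ {x} Gs → x ∈ vars Gs → OccursH x (map ⌜_⌝ Gs)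
∈vars⇒occurs ((xs , ys) ∷ Gs) x∈ with ∈-++⁻ xs x∈
... | inj₁ x∈xs = here (inj₁ (Any-map⁺ x∈xs))
... | inj₂ x∈ys++ with ∈-++⁻ ys x∈ys++
...   | inj₁ x∈ys   = here (inj₂ (Any-map⁺ x∈ys))
...   | inj₂ x∈vars = there (∈vars⇒occurs Gs x∈vars)

occurs⇒∈vars : ∀ {x} Gs → OccursH x (map ⌜_⌝ Gs) → x ∈ vars Gs
occurs⇒∈vars ((xs , ys) ∷ Gs) (here (inj₁ occ)) = ∈-++⁺ˡ (Any-map⁻ occ)
occurs⇒∈vars ((xs , ys) ∷ Gs) (here (inj₂ occ)) = ∈-++⁺ʳ xs (∈-++⁺ˡ (Any-map⁻ occ))
occurs⇒∈vars ((xs , ys) ∷ Gs) (there occ)       = ∈-++⁺ʳ xs (∈-++⁺ʳ ys (occurs⇒∈vars Gs occ))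

varsEmpty? : ∀ Gs → vars Gs ≡ [] ⊎ Σ Var (_∈ vars Gs)
varsEmpty? Gs with vars Gs
... | []    = inj₁ refl
... | x ∷ _ = inj₂ (x , here refl)

decideEmpty : ∀ {q} Gs → vars Gs ≡ [] → DecidedAtomic q Gs
decideEmpty []               _  = inj₂ ((λ _ → 0ℚ) , [])
decideEmpty ((xs , ys) ∷ Gs) eq with ++-conicalˡ xs _ eq | ++-conicalˡ ys _ (++-conicalʳ xs _ eq)
... | refl | refl = inj₁ (⊢-weaken _ ax∅)

decideAtomic : ∀ V Gs → All (Over V) Gs → ∀ q → DecidedAtomic q Gs
decideAtomic = WF.All.wfRec (On.wellFounded length <-wellFounded) _ Decider step
  where
  Decider : List Var → Set
  Decider V = ∀ Gs → All (Over V) Gs → ∀ q → DecidedAtomic q Gs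
  step : ∀ V → (∀ {W} → length W ℕ.< length V → Decider W) → Decider V
  step V ih Gs Gs⊆V q = decideBy (q ∈? vars Gs) (varsEmpty? Gs)
    where
    eliminating : ∀ x → x ∈ vars Gs → DecidedAtomic x Gs
    eliminating x x∈Gs = eliminateVar (λ Hs Hs⊆ → ih (∖-shorter (vars⊆ Gs Gs⊆V x∈Gs)) Hs Hs⊆ x) Gs Gs⊆V
    decideBy : Dec (q ∈ vars Gs) → vars Gs ≡ [] ⊎ Σ Var (_∈ vars Gs) → DecidedAtomic q Gs
    decideBy (yes q∈Gs) _                 = eliminating q q∈Gs
    decideBy (no _)     (inj₁ empty)      = decideEmpty Gs empty
    decideBy (no q∉Gs)  (inj₂ (x , x∈Gs)) =
      Sum.map₁ (shift (∈vars⇒occurs Gs x∈Gs) (q∉Gs ∘ occurs⇒∈vars Gs)) (eliminating x x∈Gs)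

weight : Formula → ℕ
weight (var _) = 1
weight t       = 2
weight (A ⊕ B) = suc (weight A ℕ.* weight B)
weight (A ⇒ B) = suc (weight A ℕ.* weight B)
weight (A ∧ B) = suc (weight A ℕ.+ weight B)
weight (A ∨ B) = suc (weight A ℕ.+ weight B)
weight (¬ᶠ A)  = suc (weight A)

-- Multiplicative, so that the rules duplicating a context still lower it.
componentWeight : Sequent → ℕ
componentWeight (Γ , Δ) = product (map weight (Γ ++ Δ))

hyperWeight : Hypersequent → ℕ
hyperWeight G = sum (map componentWeight G)

componentWeight-nonZero : ∀ S → NonZero (componentWeight S)
componentWeight-nonZero (Γ , Δ) = product≢0 (All-map⁺ (All.universal weight-nonZero (Γ ++ Δ)))
  where
  weight-nonZero : ∀ A → NonZero (weight A)
  weight-nonZero (var _) = _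
  weight-nonZero t       = _
  weight-nonZero (_ ⊕ _) = _
  weight-nonZero (_ ⇒ _) = _
  weight-nonZero (_ ∧ _) = _
  weight-nonZero (_ ∨ _) = _
  weight-nonZero (¬ᶠ _)  = _

componentWeight-↭ : ∀ {Γ Δ Γ′ Δ′} → Γ ↭ Γ′ → Δ ↭ Δ′
                  → componentWeight (Γ , Δ) ≡ componentWeight (Γ′ , Δ′)
componentWeight-↭ πΓ πΔ = product-↭ (map-↭⁺ weight (++-↭⁺ πΓ πΔ))

componentWeight-∷ʳ : ∀ A Γ Δ → componentWeight (Γ , A ∷ Δ) ≡ weight A ℕ.* componentWeight (Γ , Δ)
componentWeight-∷ʳ A Γ Δ = product-↭ (map-↭⁺ weight (↭-shift A Γ Δ))

hyperWeight-resp-≈H : ∀ {G G′} → G ≈H G′ → hyperWeight G ≡ hyperWeight G′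
hyperWeight-resp-≈H (_ , π , pointwise) =
  trans (sum-↭ (map-↭⁺ componentWeight π)) (pointwise-weight pointwise)
  where
  pointwise-weight : ∀ {H H′} → Pointwise _≈S_ H H′ → hyperWeight H ≡ hyperWeight H′
  pointwise-weight []                      = refl
  pointwise-weight ((πΓ , πΔ) ∷ pointwise) = cong₂ ℕ._+_ (componentWeight-↭ πΓ πΔ) (pointwise-weight pointwise)

belowˡ : ∀ {k P} X Γ Δ → k ℕ.< weight X → P ≡ k ℕ.* componentWeight (Γ , Δ)
       → P ℕ.< componentWeight (X ∷ Γ , Δ)
belowˡ X Γ Δ k<w refl = ℕₚ.*-monoˡ-< (componentWeight (Γ , Δ)) {{componentWeight-nonZero (Γ , Δ)}} k<w

belowʳ : ∀ {k P} X Γ Δ → k ℕ.< weight X → P ≡ k ℕ.* componentWeight (Γ , Δ)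
       → P ℕ.< componentWeight (Γ , X ∷ Δ)
belowʳ X Γ Δ k<w eq = subst (_ ℕ.<_) (sym (componentWeight-∷ʳ X Γ Δ)) (belowˡ X Γ Δ k<w eq)

record Premises (q : Var) (S : Sequent) (G : Hypersequent) : Set where
  field
    lighter₁ : ∀ {S′} → componentWeight S′ ℕ.< componentWeight S → Decided q (S′ ∷ G)
    lighter₂ : ∀ {S₁ S₂} → componentWeight S₁ ℕ.+ componentWeight S₂ ℕ.< componentWeight S
             → Decided q (S₁ ∷ S₂ ∷ G)

premises : ∀ {q} S G → (∀ H → hyperWeight H ℕ.< hyperWeight (S ∷ G) → Decided q H) → Premises q S G
premises S G ih = record
  { lighter₁ = λ {S′} w< → ih (S′ ∷ G) (ℕₚ.+-monoˡ-< (hyperWeight G) w<)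
  ; lighter₂ = λ {S₁} {S₂} w< → ih (S₁ ∷ S₂ ∷ G)
      (subst (ℕ._< hyperWeight (S ∷ G))
             (ℕₚ.+-assoc (componentWeight S₁) (componentWeight S₂) (hyperWeight G))
             (ℕₚ.+-monoˡ-< (hyperWeight G) w<)) }

decided-unary : ∀ {q S′ S G} → (⊢[ q ] S′ ∷ G → ⊢[ q ] S ∷ G) → (∀ {v} → Falsifies v S′ → Falsifies v S)
              → Decided q (S′ ∷ G) → Decided q (S ∷ G)
decided-unary rule _     (inj₁ d)            = inj₁ (rule d)
decided-unary _    truth (inj₂ (v , f ∷ fs)) = inj₂ (v , truth f ∷ fs)

decided-binary : ∀ {q S₁ S₂ S G} → (⊢[ q ] S₁ ∷ G → ⊢[ q ] S₂ ∷ G → ⊢[ q ] S ∷ G)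
               → (∀ {v} → Falsifies v S₁ → Falsifies v S) → (∀ {v} → Falsifies v S₂ → Falsifies v S)
               → Decided q (S₁ ∷ G) → Decided q (S₂ ∷ G) → Decided q (S ∷ G)
decided-binary rule _      _      (inj₁ d₁)           (inj₁ d₂)           = inj₁ (rule d₁ d₂)
decided-binary _    truth₁ _      (inj₂ (v , f ∷ fs)) _                   = inj₂ (v , truth₁ f ∷ fs)
decided-binary _    _      truth₂ (inj₁ _)            (inj₂ (v , f ∷ fs)) = inj₂ (v , truth₂ f ∷ fs)

decided-split : ∀ {q S₁ S₂ S G} → (⊢[ q ] S₁ ∷ S₂ ∷ G → ⊢[ q ] S ∷ G)
              → (∀ {v} → Falsifies v S₁ → Falsifies v S₂ → Falsifies v S)
              → Decided q (S₁ ∷ S₂ ∷ G) → Decided q (S ∷ G)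
decided-split rule _     (inj₁ d)                 = inj₁ (rule d)
decided-split _    truth (inj₂ (v , f₁ ∷ f₂ ∷ fs)) = inj₂ (v , truth f₁ f₂ ∷ fs)

module _ {q : Var} {G : Hypersequent} {Γ Δ : List Formula} where

  decided-tl : Decided q ((Γ , Δ) ∷ G) → Decided q ((t ∷ Γ , Δ) ∷ G)
  decided-tl = decided-unary tl λ {v} → subst (sumV v Δ <_) (sym (+-identityˡ (sumV v Γ)))

  decided-tr : Decided q ((Γ , Δ) ∷ G) → Decided q ((Γ , t ∷ Δ) ∷ G)
  decided-tr = decided-unary tr λ {v} → subst (_< sumV v Γ) (sym (+-identityˡ (sumV v Δ)))

  decided-¬l : ∀ {A} → Decided q ((Γ , A ∷ Δ) ∷ G) → Decided q ((¬ᶠ A ∷ Γ , Δ) ∷ G)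
  decided-¬l {A} = decided-unary ¬l λ {v} f → <-by-difference f (regroup (⟦ A ⟧ v) (sumV v Δ) (sumV v Γ))
    where
    regroup : ∀ a d g → g - (a + d) ≡ - a + g - d
    regroup = solve-∀ ℚ-ring

  decided-¬r : ∀ {A} → Decided q ((A ∷ Γ , Δ) ∷ G) → Decided q ((Γ , ¬ᶠ A ∷ Δ) ∷ G)
  decided-¬r {A} = decided-unary ¬r λ {v} f → <-by-difference f (regroup (⟦ A ⟧ v) (sumV v Δ) (sumV v Γ))
    where
    regroup : ∀ a d g → a + g - d ≡ g - (- a + d)
    regroup = solve-∀ ℚ-ring

  decided-⇒l : ∀ {A B} → Decided q ((B ∷ Γ , A ∷ Δ) ∷ G) → Decided q (((A ⇒ B) ∷ Γ , Δ) ∷ G)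
  decided-⇒l {A} {B} =
    decided-unary ⇒l λ {v} f → <-by-difference f (regroup (⟦ A ⟧ v) (⟦ B ⟧ v) (sumV v Δ) (sumV v Γ))
    where
    regroup : ∀ a b d g → b + g - (a + d) ≡ b - a + g - d
    regroup = solve-∀ ℚ-ring

  decided-⇒r : ∀ {A B} → Decided q ((A ∷ Γ , B ∷ Δ) ∷ G) → Decided q ((Γ , (A ⇒ B) ∷ Δ) ∷ G)
  decided-⇒r {A} {B} =
    decided-unary ⇒r λ {v} f → <-by-difference f (regroup (⟦ A ⟧ v) (⟦ B ⟧ v) (sumV v Δ) (sumV v Γ))
    where
    regroup : ∀ a b d g → a + g - (b + d) ≡ g - (b - a + d)
    regroup = solve-∀ ℚ-ring

  decided-⊕l : ∀ {A B} → Decided q ((A ∷ B ∷ Γ , Δ) ∷ G) → Decided q ((A ⊕ B ∷ Γ , Δ) ∷ G)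
  decided-⊕l {A} {B} =
    decided-unary ⊕l λ {v} → subst (sumV v Δ <_) (sym (+-assoc (⟦ A ⟧ v) (⟦ B ⟧ v) (sumV v Γ)))

  decided-⊕r : ∀ {A B} → Decided q ((Γ , A ∷ B ∷ Δ) ∷ G) → Decided q ((Γ , A ⊕ B ∷ Δ) ∷ G)
  decided-⊕r {A} {B} =
    decided-unary ⊕r λ {v} → subst (_< sumV v Γ) (sym (+-assoc (⟦ A ⟧ v) (⟦ B ⟧ v) (sumV v Δ)))

  decided-∧l : ∀ {A B} → Decided q ((A ∷ Γ , Δ) ∷ (B ∷ Γ , Δ) ∷ G) → Decided q ((A ∧ B ∷ Γ , Δ) ∷ G)
  decided-∧l {A} {B} = decided-split ∧l smaller
    where
    smaller : ∀ {v} → Falsifies v (A ∷ Γ , Δ) → Falsifies v (B ∷ Γ , Δ) → Falsifies v (A ∧ B ∷ Γ , Δ)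
    smaller {v} fA fB with ⊓-sel (⟦ A ⟧ v) (⟦ B ⟧ v)
    ... | inj₁ a⊓b≡a = subst (λ m → sumV v Δ < m + sumV v Γ) (sym a⊓b≡a) fA
    ... | inj₂ a⊓b≡b = subst (λ m → sumV v Δ < m + sumV v Γ) (sym a⊓b≡b) fB

  decided-∧r : ∀ {A B} → Decided q ((Γ , A ∷ Δ) ∷ G) → Decided q ((Γ , B ∷ Δ) ∷ G)
             → Decided q ((Γ , A ∧ B ∷ Δ) ∷ G)
  decided-∧r {A} {B} = decided-binary ∧r
    (λ {v} → ≤-<-trans (+-monoˡ-≤ (sumV v Δ) (p⊓q≤p (⟦ A ⟧ v) (⟦ B ⟧ v))))
    (λ {v} → ≤-<-trans (+-monoˡ-≤ (sumV v Δ) (p⊓q≤q (⟦ A ⟧ v) (⟦ B ⟧ v))))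

  decided-∨l : ∀ {A B} → Decided q ((A ∷ Γ , Δ) ∷ G) → Decided q ((B ∷ Γ , Δ) ∷ G)
             → Decided q ((A ∨ B ∷ Γ , Δ) ∷ G)
  decided-∨l {A} {B} = decided-binary ∨l
    (λ {v} f → <-≤-trans f (+-monoˡ-≤ (sumV v Γ) (p≤p⊔q (⟦ A ⟧ v) (⟦ B ⟧ v))))
    (λ {v} f → <-≤-trans f (+-monoˡ-≤ (sumV v Γ) (p≤q⊔p (⟦ A ⟧ v) (⟦ B ⟧ v))))

  decided-∨r : ∀ {A B} → Decided q ((Γ , A ∷ Δ) ∷ (Γ , B ∷ Δ) ∷ G) → Decided q ((Γ , A ∨ B ∷ Δ) ∷ G)
  decided-∨r {A} {B} = decided-split ∨r larger
    where
    larger : ∀ {v} → Falsifies v (Γ , A ∷ Δ) → Falsifies v (Γ , B ∷ Δ) → Falsifies v (Γ , A ∨ B ∷ Δ)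
    larger {v} fA fB with ⊔-sel (⟦ A ⟧ v) (⟦ B ⟧ v)
    ... | inj₁ a⊔b≡a = subst (λ m → m + sumV v Δ < sumV v Γ) (sym a⊔b≡a) fA
    ... | inj₂ a⊔b≡b = subst (λ m → m + sumV v Δ < sumV v Γ) (sym a⊔b≡b) fB

isAtom? : ∀ A → Dec (IsAtom A)
isAtom? (var x) = yes (x , refl)
isAtom? t       = no λ { (_ , ()) }
isAtom? (_ ⊕ _) = no λ { (_ , ()) }
isAtom? (_ ⇒ _) = no λ { (_ , ()) }
isAtom? (_ ∧ _) = no λ { (_ , ()) }
isAtom? (_ ∨ _) = no λ { (_ , ()) }
isAtom? (¬ᶠ _)  = no λ { (_ , ()) }

atomsOrPrincipal : ∀ Γ → Σ (List Var) (λ xs → map var xs ≡ Γ)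
                       ⊎ Σ Formula λ X → Σ (List Formula) λ Γ′ → ¬ IsAtom X × X ∷ Γ′ ↭ Γ
atomsOrPrincipal []      = inj₁ ([] , refl)
atomsOrPrincipal (A ∷ Γ) with isAtom? A | atomsOrPrincipal Γ
... | no A̸           | _                      = inj₂ (A , Γ , A̸ , ↭-refl)
... | yes (x , refl) | inj₁ (xs , refl)       = inj₁ (x ∷ xs , refl)
... | yes (x , refl) | inj₂ (X , Γ′ , X̸ , π) =
  inj₂ (X , var x ∷ Γ′ , X̸ , ↭-trans (swap X (var x) ↭-refl) (prep (var x) π))

data Shape (G : Hypersequent) : Set where
  atomic     : ∀ Gs → map ⌜_⌝ Gs ≡ G → Shape G
  principalˡ : ∀ X Γ Δ H → ¬ IsAtom X → ((X ∷ Γ , Δ) ∷ H) ≈H G → Shape G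
  principalʳ : ∀ X Γ Δ H → ¬ IsAtom X → ((Γ , X ∷ Δ) ∷ H) ≈H G → Shape G

≈H-under : ∀ {S T H G} → (S ∷ H) ≈H G → (S ∷ T ∷ H) ≈H (T ∷ G)
≈H-under {S} {T} (G″ , π , pointwise) = T ∷ G″ , ↭-trans (swap S T ↭-refl) (prep T π) , ≈S-refl ∷ pointwise

classify : ∀ G → Shape G
classify []            = atomic [] refl
classify ((Γ , Δ) ∷ G) with atomsOrPrincipal Γ | atomsOrPrincipal Δ
... | inj₂ (X , Γ′ , X̸ , π) | _                      = principalˡ X Γ′ Δ G X̸ (head-≈H π ↭-refl)
... | inj₁ _                | inj₂ (X , Δ′ , X̸ , π) = principalʳ X Γ Δ′ G X̸ (head-≈H ↭-refl π)
... | inj₁ (xs , refl)      | inj₁ (ys , refl) with classify G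
...   | atomic Gs refl           = atomic ((xs , ys) ∷ Gs) refl
...   | principalˡ X Γ′ Δ′ H X̸ ≈ = principalˡ X Γ′ Δ′ (⌜ xs , ys ⌝ ∷ H) X̸ (≈H-under ≈)
...   | principalʳ X Γ′ Δ′ H X̸ ≈ = principalʳ X Γ′ Δ′ (⌜ xs , ys ⌝ ∷ H) X̸ (≈H-under ≈)

reduceˡ : ∀ {q} X Γ Δ G → ¬ IsAtom X → Premises q (X ∷ Γ , Δ) G → Decided q ((X ∷ Γ , Δ) ∷ G)
reduceˡ (var x) Γ Δ G X̸ _ = ⊥-elim (X̸ (x , refl))
reduceˡ t Γ Δ G _ ih = decided-tl (lighter₁ (belowˡ t Γ Δ (ℕₚ.n<1+n 1) (sym (ℕₚ.*-identityˡ _))))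
  where open Premises ih
reduceˡ (¬ᶠ A) Γ Δ G _ ih =
  decided-¬l (lighter₁ (belowˡ (¬ᶠ A) Γ Δ (ℕₚ.n<1+n _) (componentWeight-∷ʳ A Γ Δ)))
  where open Premises ih
reduceˡ (A ⇒ B) Γ Δ G _ ih = decided-⇒l (lighter₁ (belowˡ (A ⇒ B) Γ Δ (ℕₚ.n<1+n _)
    (trans (cong (weight B ℕ.*_) (componentWeight-∷ʳ A Γ Δ)) (*-swapˡ (weight B) (weight A) _))))
  where
  open Premises ih
  *-swapˡ : ∀ b a r → b ℕ.* (a ℕ.* r) ≡ a ℕ.* b ℕ.* r
  *-swapˡ b a r = trans (sym (ℕₚ.*-assoc b a r)) (cong (ℕ._* r) (ℕₚ.*-comm b a))
reduceˡ (A ⊕ B) Γ Δ G _ ih =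
  decided-⊕l (lighter₁ (belowˡ (A ⊕ B) Γ Δ (ℕₚ.n<1+n _) (sym (ℕₚ.*-assoc (weight A) (weight B) _))))
  where open Premises ih
reduceˡ (A ∧ B) Γ Δ G _ ih =
  decided-∧l (lighter₂ (belowˡ (A ∧ B) Γ Δ (ℕₚ.n<1+n _) (sym (ℕₚ.*-distribʳ-+ _ (weight A) (weight B)))))
  where open Premises ih
reduceˡ (A ∨ B) Γ Δ G _ ih =
  decided-∨l (lighter₁ (belowˡ (A ∨ B) Γ Δ (ℕ.s≤s (ℕₚ.m≤m+n (weight A) (weight B))) refl))
             (lighter₁ (belowˡ (A ∨ B) Γ Δ (ℕ.s≤s (ℕₚ.m≤n+m (weight B) (weight A))) refl))
  where open Premises ih

reduceʳ : ∀ {q} X Γ Δ G → ¬ IsAtom X → Premises q (Γ , X ∷ Δ) G → Decided q ((Γ , X ∷ Δ) ∷ G)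
reduceʳ (var x) Γ Δ G X̸ _ = ⊥-elim (X̸ (x , refl))
reduceʳ t Γ Δ G _ ih = decided-tr (lighter₁ (belowʳ t Γ Δ (ℕₚ.n<1+n 1) (sym (ℕₚ.*-identityˡ _))))
  where open Premises ih
reduceʳ (¬ᶠ A) Γ Δ G _ ih = decided-¬r (lighter₁ (belowʳ (¬ᶠ A) Γ Δ (ℕₚ.n<1+n _) refl))
  where open Premises ih
reduceʳ (A ⇒ B) Γ Δ G _ ih = decided-⇒r (lighter₁ (belowʳ (A ⇒ B) Γ Δ (ℕₚ.n<1+n _)
    (trans (cong (weight A ℕ.*_) (componentWeight-∷ʳ B Γ Δ)) (sym (ℕₚ.*-assoc (weight A) (weight B) _)))))
  where open Premises ih
reduceʳ (A ⊕ B) Γ Δ G _ ih = decided-⊕r (lighter₁ (belowʳ (A ⊕ B) Γ Δ (ℕₚ.n<1+n _)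
    (trans (componentWeight-∷ʳ A Γ (B ∷ Δ))
      (trans (cong (weight A ℕ.*_) (componentWeight-∷ʳ B Γ Δ)) (sym (ℕₚ.*-assoc (weight A) (weight B) _))))))
  where open Premises ih
reduceʳ (A ∧ B) Γ Δ G _ ih =
  decided-∧r
    (lighter₁ (belowʳ (A ∧ B) Γ Δ (ℕ.s≤s (ℕₚ.m≤m+n (weight A) (weight B))) (componentWeight-∷ʳ A Γ Δ)))
    (lighter₁ (belowʳ (A ∧ B) Γ Δ (ℕ.s≤s (ℕₚ.m≤n+m (weight B) (weight A))) (componentWeight-∷ʳ B Γ Δ)))
  where open Premises ih
reduceʳ (A ∨ B) Γ Δ G _ ih = decided-∨r (lighter₂ (belowʳ (A ∨ B) Γ Δ (ℕₚ.n<1+n _)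
    (trans (cong₂ ℕ._+_ (componentWeight-∷ʳ A Γ Δ) (componentWeight-∷ʳ B Γ Δ))
           (sym (ℕₚ.*-distribʳ-+ _ (weight A) (weight B))))))
  where open Premises ih

decide : ∀ q G → Decided q G
decide q = WF.All.wfRec (On.wellFounded hyperWeight <-wellFounded) _ (Decided q) step
  where
  step : ∀ G → (∀ {H} → hyperWeight H ℕ.< hyperWeight G → Decided q H) → Decided q G
  step G ih = byShape (classify G)
    where
    lighter : ∀ {P} → P ≈H G → ∀ H → hyperWeight H ℕ.< hyperWeight P → Decided q H
    lighter P≈G H h = ih (subst (hyperWeight H ℕ.<_) (hyperWeight-resp-≈H P≈G) h)
    byShape : Shape G → Decided q G
    byShape (atomic Gs Gs≡G) =
      subst (Decided q) Gs≡G (decidedAtomic⇒decided (decideAtomic (vars Gs) Gs (over-vars Gs) q))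
    byShape (principalˡ X Γ Δ H X̸ P≈G) =
      decided-resp-≈H P≈G (reduceˡ X Γ Δ H X̸ (premises (X ∷ Γ , Δ) H (lighter P≈G)))
    byShape (principalʳ X Γ Δ H X̸ P≈G) =
      decided-resp-≈H P≈G (reduceʳ X Γ Δ H X̸ (premises (Γ , X ∷ Δ) H (lighter P≈G)))

mainTheorem10 : (G : Hypersequent) → Valid G → (p : Var) → ⊢[ p ] G
mainTheorem10 G valid p with decide p G
... | inj₁ derivation   = derivation
... | inj₂ countermodel = ⊥-elim (valid⇒¬countermodel valid countermodel)
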